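{- Let $C$ be a positive integer. An aperiodic recurrent infinite word that is uniformly factor-balanced with constant $C$ is $(2C+3)$-power-free.
   Context: An infinite word is aperiodic if it is not periodic (not of the form $vvv\cdots$), recurrent if each factor occurs infinitely often, and uniformly factor-balanced with constant $C$ if $\big||u|_w-|v|_w\big|\le C$ for every finite word $w$ and all factors $u,v$ of equal length ($|u|_w$ counts possibly overlapping occurrences). $P$-power-free means no factor of the form $z^P$ with $z$ nonempty. -}

module Defs where

open import Data.Nat using (ℕ; zero; suc; _+_; _*_; _∸_; _≤_; _<_)
open import Data.List using (List; []; _∷_; length; map; upTo; _++_)
open import Data.Bool using (Bool; true; false)
open import Data.Product using (Σ; ∃; _×_; _,_)
open import Relation.Nullary using (¬_; yes; no)
open import Relation.Binary.Definitions using (DecidableEquality)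
open import Relation.Binary.PropositionalEquality using (_≡_)

Word : Set → Set
Word A = ℕ → A

factor : {A : Set} → Word A → ℕ → ℕ → List A
factor x i n = map (λ k → x (i + k)) (upTo n)

IsFactor : {A : Set} → Word A → List A → Set
IsFactor x u = ∃ λ i → factor x i (length u) ≡ u

module _ {A : Set} (_≟_ : DecidableEquality A) where

  isPrefix : List A → List A → Bool
  isPrefix [] u = true
  isPrefix (a ∷ w) [] = false
  isPrefix (a ∷ w) (b ∷ u) with a ≟ b
  ... | yes _ = isPrefix w u
  ... | no _ = false

  -- |u|_w : number of (possibly overlapping) occurrences of w in u,
  -- i.e. number of positions j of u such that w is a prefix of the suffix of u at j.
  -- (Convention: the empty word occurs at each of the |u|+1 positions.)
  occ : List A → List A → ℕ
  occ [] w with isPrefix w []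
  ... | true = 1
  ... | false = 0
  occ (b ∷ u) w with isPrefix w (b ∷ u)
  ... | true = suc (occ u w)
  ... | false = occ u w

  dist : ℕ → ℕ → ℕ
  dist m n = (m ∸ n) + (n ∸ m)

  UniformlyFactorBalanced : ℕ → Word A → Set
  UniformlyFactorBalanced C x =
    (w : List A) (u v : List A) → IsFactor x u → IsFactor x v →
    length u ≡ length v → dist (occ u w) (occ v w) ≤ C

Periodic : {A : Set} → Word A → Set
Periodic x = Σ (List _) λ v → (0 < length v) × ((n : ℕ) → factor x (n * length v) (length v) ≡ v)

Aperiodic : {A : Set} → Word A → Set
Aperiodic x = ¬ Periodic x

Recurrent : {A : Set} → Word A → Set
Recurrent x = (u : List _) → IsFactor x u → (m : ℕ) → ∃ λ j → (m < j) × (factor x j (length u) ≡ u)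

power : {A : Set} → List A → ℕ → List A
power z zero = []
power z (suc P) = z ++ power z P

PowerFree : {A : Set} → ℕ → Word A → Set
PowerFree P x = (z : List _) → 0 < length z → ¬ IsFactor x (power z P)

{-# OPTIONS --safe #-}
module Submission where

-- Let z^(2C+3) occur in x, with |z| = p and b the first letter of z, and put
-- w = z^(C+2) b and M = (C+1)p.  The factor z^(2C+3) contains at least C+1
-- occurrences of w.  Any factor v of the same length which contains w at all
-- contains it at an offset a ≤ M, and since w has period p and length M + p + 1
-- this occurrence covers the positions M and M + p of v, whence v[M] = v[M+p].
-- Balance forbids v from avoiding w, so x e = x (e + p) for every e ≥ M, and
-- recurrence carries this back to every position: x is periodic.

open import Defs
open import Data.Bool using (true; false)
open import Data.List using (List; []; _∷_; [_]; _++_; _∷ʳ_; length; map; upTo; applyUpTo)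
open import Data.List.Membership.Propositional using (_∈_)
open import Data.List.Membership.Propositional.Properties using (∈-upTo⁺)
open import Data.List.Properties
  using (++-assoc; ++-identityʳ; ∷-injective; length-++; length-++-≤ˡ; length-map; length-upTo; map-cong;
         map-upTo; map-applyUpTo)
open import Data.List.Relation.Unary.Any using (here; there)
open import Data.Nat using (ℕ; zero; suc; _+_; _*_; _∸_; _≤_; _<_; z≤n; s≤s; z<s)
open import Data.Nat.Properties
open import Algebra.Properties.CommutativeSemigroup +-commutativeSemigroup
  using (xy∙z≈xz∙y; xy∙z≈yz∙x)
open import Data.Nat.Tactic.RingSolver using (solve-∀)
open import Data.Product using (∃; ∃₂; _×_; _,_; proj₁; proj₂; map₁; map₂)
open import Function using (_∘_)
open import Relation.Binary.Definitions using (DecidableEquality)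
open import Relation.Binary.PropositionalEquality hiding ([_])
open import Relation.Nullary using (yes; no; contradiction)

private
  variable
    A B : Set

++-injective : {ws xs ys zs : List A} →
  length ws ≡ length xs → ws ++ ys ≡ xs ++ zs → ws ≡ xs × ys ≡ zs
++-injective {ws = []}     {[]}     _    eq = refl , eq
++-injective {ws = a ∷ ws} {_ ∷ xs} |ws| eq with refl , eq′ ← ∷-injective eq =
  map₁ (cong (a ∷_)) (++-injective (suc-injective |ws|) eq′)

map-≡⇒≡ : {f g : A → B} {xs : List A} {a : A} → map f xs ≡ map g xs → a ∈ xs → f a ≡ g a
map-≡⇒≡ {xs = _ ∷ _} eq (here refl) = proj₁ (∷-injective eq)
map-≡⇒≡ {xs = _ ∷ _} eq (there a∈) = map-≡⇒≡ (proj₂ (∷-injective eq)) a∈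

power-+ : (z : List A) (m n : ℕ) → power z (m + n) ≡ power z m ++ power z n
power-+ z zero    n = refl
power-+ z (suc m) n = trans (cong (z ++_) (power-+ z m n)) (sym (++-assoc z (power z m) _))

power-sucʳ : (z : List A) (m : ℕ) → power z (suc m) ≡ power z m ++ z
power-sucʳ z m = begin
  power z (1 + m)          ≡⟨ cong (power z) (+-comm 1 m) ⟩
  power z (m + 1)          ≡⟨ power-+ z m 1 ⟩
  power z m ++ (z ++ [])   ≡⟨ cong (power z m ++_) (++-identityʳ z) ⟩
  power z m ++ z           ∎
  where open ≡-Reasoning

power-suc≡∷ʳ++ : (b : A) (z′ : List A) (m : ℕ) →
  power (b ∷ z′) (suc m) ≡ (power (b ∷ z′) m ∷ʳ b) ++ z′
power-suc≡∷ʳ++ b z′ m =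
  trans (power-sucʳ (b ∷ z′) m) (sym (++-assoc (power (b ∷ z′) m) [ b ] z′))

module _ (_≟_ : DecidableEquality A) where

  isPrefix-complete : (w : List A) {u v : List A} → u ≡ w ++ v → isPrefix _≟_ w u ≡ true
  isPrefix-complete []      _    = refl
  isPrefix-complete (a ∷ w) refl with a ≟ a
  ... | yes _   = isPrefix-complete w refl
  ... | no a≢a = contradiction refl a≢a

  isPrefix-sound : (w u : List A) → isPrefix _≟_ w u ≡ true → ∃ λ v → u ≡ w ++ v
  isPrefix-sound []      u       _   = u , refl
  isPrefix-sound (a ∷ w) (b ∷ u) pre with a ≟ b
  ... | yes refl = map₂ (cong (a ∷_)) (isPrefix-sound w u pre)

  isPrefix⇒occ-pos : (u : List A) {w : List A} → isPrefix _≟_ w u ≡ true → 0 < occ _≟_ u w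
  isPrefix⇒occ-pos []      pre rewrite pre = z<s
  isPrefix⇒occ-pos (_ ∷ _) pre rewrite pre = z<s

  occ-∷-isPrefix : {b : A} {u w : List A} →
    isPrefix _≟_ w (b ∷ u) ≡ true → occ _≟_ (b ∷ u) w ≡ suc (occ _≟_ u w)
  occ-∷-isPrefix pre rewrite pre = refl

  occ-++-≤ʳ : (y : List A) {u w : List A} → occ _≟_ u w ≤ occ _≟_ (y ++ u) w
  occ-++-≤ʳ []                = ≤-refl
  occ-++-≤ʳ (b ∷ y) {u} {w} with isPrefix _≟_ w (b ∷ y ++ u)
  ... | true  = m≤n⇒m≤1+n (occ-++-≤ʳ y)
  ... | false = occ-++-≤ʳ y

  occ-pos⇒infix : (u : List A) {w : List A} → 0 < occ _≟_ u w → ∃₂ λ y v → u ≡ y ++ w ++ v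
  occ-pos⇒infix []      {w} pos with isPrefix _≟_ w [] in pre
  ... | true = [] , isPrefix-sound w [] pre
  occ-pos⇒infix (b ∷ u) {w} pos with isPrefix _≟_ w (b ∷ u) in pre
  ... | true  = [] , isPrefix-sound w (b ∷ u) pre
  ... | false with y , v , eq ← occ-pos⇒infix u pos = b ∷ y , v , cong (b ∷_) eq

  occ-power : {b : A} {z′ w r : List A} (m : ℕ) → power (b ∷ z′) m ≡ w ++ r →
    (k : ℕ) → k < occ _≟_ (power (b ∷ z′) (k + m)) w
  occ-power {b} {z′} {w} m eq zero = isPrefix⇒occ-pos (power (b ∷ z′) m) (isPrefix-complete w eq)
  occ-power {b} {z′} {w} {r} m eq (suc k) =
    subst (suc k <_) (sym (occ-∷-isPrefix {b} {z′ ++ power z (k + m)} (isPrefix-complete w shifted)))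
      (s≤s (≤-trans (occ-power {b} {z′} {w} {r} m eq k) (occ-++-≤ʳ z′)))
    where
      open ≡-Reasoning
      z : List A
      z = b ∷ z′
      shifted : power z (suc k + m) ≡ w ++ r ++ power z (suc k)
      shifted = begin
        power z (suc k + m)               ≡⟨ cong (power z) (+-comm (suc k) m) ⟩
        power z (m + suc k)               ≡⟨ power-+ z m (suc k) ⟩
        power z m ++ power z (suc k)      ≡⟨ cong (_++ power z (suc k)) eq ⟩
        (w ++ r) ++ power z (suc k)       ≡⟨ ++-assoc w r _ ⟩
        w ++ r ++ power z (suc k)         ∎

HasPeriodFrom : ℕ → ℕ → Word A → Set
HasPeriodFrom p m x = ∀ e → m ≤ e → x e ≡ x (e + p)

module _ (x : Word A) where

  length-factor : (t n : ℕ) → length (factor x t n) ≡ n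
  length-factor t n = trans (length-map _ (upTo n)) (length-upTo n)

  factor-isFactor : (t n : ℕ) → IsFactor x (factor x t n)
  factor-isFactor t n = t , cong (factor x t) (length-factor t n)

  factor-suc : (t n : ℕ) → factor x t (suc n) ≡ x t ∷ factor x (suc t) n
  factor-suc t n = cong₂ _∷_ (cong x (+-identityʳ t)) (begin
    map (λ k → x (t + k)) (applyUpTo suc n)  ≡⟨ map-applyUpTo suc _ n ⟩
    applyUpTo (λ k → x (t + suc k)) n        ≡⟨ sym (map-upTo _ n) ⟩
    map (λ k → x (t + suc k)) (upTo n)       ≡⟨ map-cong (λ k → cong x (+-suc t k)) (upTo n) ⟩
    factor x (suc t) n                       ∎)
    where open ≡-Reasoning

  factor-++ : (t m n : ℕ) → factor x t (m + n) ≡ factor x t m ++ factor x (t + m) n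
  factor-++ t zero    n = cong (λ s → factor x s n) (sym (+-identityʳ t))
  factor-++ t (suc m) n = begin
    factor x t (suc m + n)                                ≡⟨ factor-suc t (m + n) ⟩
    x t ∷ factor x (suc t) (m + n)                        ≡⟨ cong (x t ∷_) (factor-++ (suc t) m n) ⟩
    x t ∷ factor x (suc t) m ++ factor x (suc t + m) n    ≡⟨ cong₂ _++_ (sym (factor-suc t m))
                                                               (cong (λ s → factor x s n) (sym (+-suc t m))) ⟩
    factor x t (suc m) ++ factor x (t + suc m) n          ∎
    where open ≡-Reasoning

  factor-++⁻ : {t : ℕ} (u v : List A) → factor x t (length (u ++ v)) ≡ u ++ v →
    factor x t (length u) ≡ u × factor x (t + length u) (length v) ≡ v
  factor-++⁻ {t} u v eq = ++-injective (length-factor t (length u)) (begin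
    factor x t (length u) ++ factor x (t + length u) (length v)  ≡⟨ factor-++ t (length u) (length v) ⟨
    factor x t (length u + length v)                             ≡⟨ cong (factor x t) (length-++ u) ⟨
    factor x t (length (u ++ v))                                 ≡⟨ eq ⟩
    u ++ v                                                       ∎)
    where open ≡-Reasoning

  factor-≡⇒≡ : {s t n k : ℕ} → factor x s n ≡ factor x t n → k < n → x (s + k) ≡ x (t + k)
  factor-≡⇒≡ eq k<n = map-≡⇒≡ eq (∈-upTo⁺ k<n)

  factor-border : {t : ℕ} {w z y z̃ : List A} →
    factor x t (length w) ≡ w → w ≡ z ++ y → w ≡ y ++ z̃ →
    {k : ℕ} → k < length y → x (t + k) ≡ x (t + length z + k)
  factor-border {t} {w} {z} {y} {z̃} at refl w≡yz̃ = factor-≡⇒≡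
    (trans (proj₁ (factor-++⁻ y z̃ (subst (λ v → factor x t (length v) ≡ v) w≡yz̃ at)))
           (sym (proj₂ (factor-++⁻ z y at))))

  occ-factor⇒occurrence : (_≟_ : DecidableEquality A) {s n : ℕ} {w : List A} →
    0 < occ _≟_ (factor x s n) w →
    ∃ λ a → a + length w ≤ n × factor x (s + a) (length w) ≡ w
  occ-factor⇒occurrence _≟_ {s} {n} {w} pos
    with y , v , eq ← occ-pos⇒infix _≟_ (factor x s n) pos
    with refl ← trans (sym (length-factor s n)) (cong length eq)
    = length y , bound , proj₁ (factor-++⁻ w v (proj₂ (factor-++⁻ y (w ++ v) eq)))
    where
      bound : length y + length w ≤ length (y ++ w ++ v)
      bound = ≤-trans (+-monoʳ-≤ (length y) (length-++-≤ˡ w)) (≤-reflexive (sym (length-++ y)))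

  recurrent⇒period : {p m : ℕ} → Recurrent x → HasPeriodFrom p m x → HasPeriodFrom p 0 x
  recurrent⇒period {p} {m} recurrent period n _
    with j , m<j , prefix-at-j ← recurrent (factor x 0 (suc (n + p))) (factor-isFactor 0 (suc (n + p))) m
    = begin
      x n            ≡⟨ sym (same (s≤s (m≤m+n n p))) ⟩
      x (j + n)      ≡⟨ period (j + n) (≤-trans (<⇒≤ m<j) (m≤m+n j n)) ⟩
      x (j + n + p)  ≡⟨ cong x (+-assoc j n p) ⟩
      x (j + (n + p)) ≡⟨ same ≤-refl ⟩
      x (n + p)      ∎
    where
      open ≡-Reasoning
      K : ℕ
      K = suc (n + p)
      same : {k : ℕ} → k < K → x (j + k) ≡ x k
      same = factor-≡⇒≡ (subst (λ l → factor x j l ≡ factor x 0 K) (length-factor 0 K) prefix-at-j)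

  period⇒Periodic : {p : ℕ} → 0 < p → HasPeriodFrom p 0 x → Periodic x
  period⇒Periodic {p} 0<p period =
    factor x 0 p ,
    subst (0 <_) (sym |v|) 0<p ,
    λ n → subst (λ q → factor x (n * q) q ≡ factor x 0 p) (sym |v|) (map-cong (shift n) (upTo p))
    where
      |v| : length (factor x 0 p) ≡ p
      |v| = length-factor 0 p
      shift : ∀ n k → x (n * p + k) ≡ x k
      shift zero    k = refl
      shift (suc n) k = trans (cong x (xy∙z≈yz∙x p (n * p) k))
                              (trans (sym (period (n * p + k) z≤n)) (shift n k))

module _ (_≟_ : DecidableEquality A) {x : Word A} {C : ℕ} {b : A} {z′ : List A} where
  private
    z y w u : List A
    z = b ∷ z′
    y = power z (suc C) ∷ʳ b
    w = power z (2 + C) ∷ʳ b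
    u = power z (2 * C + 3)

    p M : ℕ
    p = length z
    M = length (power z (suc C))

    w≡z++y : w ≡ z ++ y
    w≡z++y = ++-assoc z (power z (suc C)) [ b ]

    w≡y++ : w ≡ y ++ z′ ∷ʳ b
    w≡y++ = trans (cong (_∷ʳ b) (power-suc≡∷ʳ++ b z′ (suc C))) (++-assoc y z′ [ b ])

    offset≤M : {a : ℕ} → a + length w ≤ length u → a ≤ M
    offset≤M {a} bound = +-cancelʳ-≤ (length (power z (2 + C))) a M (begin
      a + length (power z (2 + C))                ≤⟨ +-monoʳ-≤ a (length-++-≤ˡ (power z (2 + C))) ⟩
      a + length w                                ≤⟨ bound ⟩
      length (power z (2 * C + 3))                ≡⟨ cong (length ∘ power z) (exponent C) ⟩
      length (power z (suc C + (2 + C)))          ≡⟨ cong length (power-+ z (suc C) (2 + C)) ⟩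
      length (power z (suc C) ++ power z (2 + C)) ≡⟨ length-++ (power z (suc C)) ⟩
      M + length (power z (2 + C))                ∎)
      where
        open ≤-Reasoning
        exponent : ∀ C → 2 * C + 3 ≡ suc C + (2 + C)
        exponent = solve-∀

  C<occ-power : C < occ _≟_ u w
  C<occ-power = subst (λ n → C < occ _≟_ (power z n) w) (exponent C)
    (occ-power _≟_ (3 + C) (power-suc≡∷ʳ++ b z′ (2 + C)) C)
    where
      exponent : ∀ C → C + (3 + C) ≡ 2 * C + 3
      exponent = solve-∀

  occ-factor⇒period : (s : ℕ) → 0 < occ _≟_ (factor x s (length u)) w → x (M + s) ≡ x (M + s + p)
  occ-factor⇒period s pos
    with a , a+|w|≤|u| , w-at-a ← occ-factor⇒occurrence x _≟_ pos
    with k , a+k≡M ← m≤n⇒∃[o]m+o≡n (offset≤M a+|w|≤|u|)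
    = subst (λ e → x e ≡ x (e + p)) (trans (+-assoc s a k) (trans (cong (s +_) a+k≡M) (+-comm s M)))
        (trans (factor-border x w-at-a w≡z++y w≡y++ k<|y|) (cong x (xy∙z≈xz∙y (s + a) p k)))
    where
      open ≤-Reasoning
      k<|y| : k < length y
      k<|y| = begin-strict
        k        ≤⟨ m≤n+m k a ⟩
        a + k    ≡⟨ a+k≡M ⟩
        M        <⟨ m<m+n M z<s ⟩
        M + 1    ≡⟨ length-++ (power z (suc C)) ⟨
        length y ∎

  balanced⇒periodFrom : UniformlyFactorBalanced _≟_ C x → IsFactor x u → HasPeriodFrom p M x
  balanced⇒periodFrom balanced u∈x e M≤e with s , refl ← m≤n⇒∃[o]m+o≡n M≤e
    with x (M + s) ≟ x (M + s + p)
  ... | yes eq  = eq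
  ... | no  neq = contradiction (balanced w u v u∈x (factor-isFactor x s (length u)) |u|≡|v|)
                                (<⇒≱ C<dist)
    where
      open ≤-Reasoning
      v : List A
      v = factor x s (length u)
      |u|≡|v| : length u ≡ length v
      |u|≡|v| = sym (length-factor x s (length u))
      w∉v : occ _≟_ v w ≡ 0
      w∉v = n≤0⇒n≡0 (≮⇒≥ (neq ∘ occ-factor⇒period s))
      C<dist : C < dist _≟_ (occ _≟_ u w) (occ _≟_ v w)
      C<dist = begin-strict
        C                                      <⟨ C<occ-power ⟩
        occ _≟_ u w                            ≡⟨ cong (occ _≟_ u w ∸_) w∉v ⟨
        occ _≟_ u w ∸ occ _≟_ v w              ≤⟨ m≤m+n _ _ ⟩
        dist _≟_ (occ _≟_ u w) (occ _≟_ v w)  ∎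

corollary4p10 : {A : Set} (_≟_ : DecidableEquality A) (C : ℕ) → 1 ≤ C →
    (x : Word A) → Aperiodic x → Recurrent x →
    UniformlyFactorBalanced _≟_ C x → PowerFree (2 * C + 3) x
corollary4p10 _   _ _ _ _         _         _        []      () _
corollary4p10 _≟_ C _ x aperiodic recurrent balanced (_ ∷ _) _  zᴾ∈x =
  aperiodic (period⇒Periodic x z<s
    (recurrent⇒period x recurrent (balanced⇒periodFrom _≟_ balanced zᴾ∈x)))
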